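{- For any positive integer $k$, define \[ D := \left\{(x,2x): x=\left\lceil \frac{k^2}{2}\right\rceil+2i\text{ with } i=0,1,\dots,k-1 \right\}. \] Then $D$ is a generic $k$-arc.
   Context: Model of $\mathrm{PG}(2,r)$ via the planar function $x^2$: points are $(x,y)$ with $x,y\in\mathbb{F}_r$ together with $(z)$, $z\in\mathbb{F}_r\cup\{\infty\}$; lines are $[a,b]$ with $a,b\in\mathbb{F}_r$ together with $[c]$, $c\in\mathbb{F}_r\cup\{\infty\}$; $(x,y)$ is incident with $[a,b]$ iff $y-b=(x-a)^2$, $(x,y)$ is incident with $[c]$ iff $x=c$, $(z)$ is incident with $[a,b]$ iff $z=b$, $(z)$ is incident with $[\infty]$, and $(\infty)$ is incident with $[c]$. An arc is a point set with no three points on a common line; a $k$-uniform local arc is a collection of pairwise disjoint $k$-point sets $S_i$ such that $S_i\cup S_j$ is an arc for any distinct $S_i,S_j$. For a positive integer $n$ let $I_n=\{0,1,\dots,n-1\}$, and for a prime $r>n$ let $\overline{(\cdot)}$ denote reduction modulo $r$ (applied coordinatewise and to sets). Let $\mathcal{S}=\{S_1,\dots,S_m\}$ be a collection of $k$-subsets of $I_n^2$ (points written $(x,y)$) and $\mathcal{L}=\{L_1,\dots,L_m\}$ a collection of $\binom{k}{2}$-subsets of $I_n^2$ (elements written $[a,b]$), with $\overline{\mathcal{S}}=\{\overline{S}:S\in\mathcal{S}\}$ and $\overline{\mathcal{L}}=\{\overline{L}:L\in\mathcal{L}\}$, satisfying: (a) $\overline{\mathcal{S}}$ is a $k$-uniform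 local arc in $\mathrm{PG}(2,r)$ defined via the planar function $x^2$; (b) for each $j$, $\overline{L_j}$ is the set of secant lines to the $k$-arc $\overline{S_j}$; (c) for any $(x,y)\in\bigcup_{S\in\mathcal{S}}S$ and any $[a,b]\in\bigcup_{L\in\mathcal{L}}L$, if $(\bar x,\bar y)$ is on $[\bar a,\bar b]$ then $(x-a)^2=y-b\geq 0$ (as integers). Such an $\mathcal{S}$ is called a generic $k$-uniform local arc, and its elements $S$ are called generic $k$-arcs. (Here the claim is that $\mathcal{S}=\{D\}$, with $\mathcal{L}$ the integer liftings of the secant lines of $\overline{D}$, satisfies (a), (b), (c).) -}

module Defs where

open import Data.Nat as ℕ using (ℕ; zero; suc; _<_; _≤_; NonZero; ⌈_/2⌉)
open import Data.Nat.DivMod using (_%_)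
open import Data.Nat.Combinatorics using (_C_)
open import Data.Nat.Primality using (Prime)
open import Data.Integer as ℤ using (ℤ; +_; _-_; _^_)
open import Data.Integer.Divisibility as ℤD using ()
open import Data.Maybe using (Maybe; just; nothing)
open import Data.Product using (Σ; ∃; _×_; _,_)
open import Data.Unit using (⊤)
open import Data.Empty using (⊥)
open import Data.Fin using (Fin)
open import Data.List using (List; length; map; upTo; _++_)
open import Data.List.Membership.Propositional using (_∈_)
open import Data.List.Relation.Unary.All using (All)
open import Data.List.Relation.Unary.Unique.Propositional using (Unique)
open import Relation.Binary.PropositionalEquality using (_≡_; _≢_)
open import Relation.Nullary using (¬_)

-- The projective plane PG(2,r) in the model given by the planar function x².
-- Elements of F_r are represented by naturals < r (F_r = ℤ/rℤ, r prime);
-- 'nothing' plays the role of ∞.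

data Pt : Set where
  aff   : ℕ → ℕ → Pt
  ptAt  : Maybe ℕ → Pt

data Ln : Set where
  par   : ℕ → ℕ → Ln
  vert  : Maybe ℕ → Ln

ValidPt : ℕ → Pt → Set
ValidPt r (aff x y)         = x < r × y < r
ValidPt r (ptAt (just z))   = z < r
ValidPt r (ptAt nothing)    = ⊤

ValidLn : ℕ → Ln → Set
ValidLn r (par a b)         = a < r × b < r
ValidLn r (vert (just c))   = c < r
ValidLn r (vert nothing)    = ⊤

-- incidence in PG(2,r); equality in F_r is congruence modulo r
Inc : ℕ → Pt → Ln → Set
Inc r (aff x y)        (par a b)        = (+ r) ℤD.∣ ((+ y - + b) - (+ x - + a) ^ 2)
Inc r (aff x y)        (vert (just c))  = x ≡ c
Inc r (aff x y)        (vert nothing)   = ⊥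
Inc r (ptAt (just z))  (par a b)        = z ≡ b
Inc r (ptAt nothing)   (par a b)        = ⊥
Inc r (ptAt z)         (vert nothing)   = ⊤
Inc r (ptAt (just z))  (vert (just c))  = ⊥
Inc r (ptAt nothing)   (vert (just c))  = ⊤

IsArc : ℕ → List Pt → Set
IsArc r T = ∀ (ℓ : Ln) → ValidLn r ℓ → ∀ p q s → p ∈ T → q ∈ T → s ∈ T →
            p ≢ q → q ≢ s → p ≢ s → Inc r p ℓ → Inc r q ℓ → Inc r s ℓ → ⊥

IsSecant : ℕ → List Pt → Ln → Set
IsSecant r T ℓ = ValidLn r ℓ × ∃ λ p → ∃ λ q → p ∈ T × q ∈ T × p ≢ q × Inc r p ℓ × Inc r q ℓ

IsLocalArc : ℕ → ℕ → {m : ℕ} → (Fin m → List Pt) → Set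
IsLocalArc r k {m} T =
    (∀ i → All (ValidPt r) (T i) × Unique (T i) × length (T i) ≡ k)
  × (∀ i j → i ≢ j → ∀ p → p ∈ T i → p ∈ T j → ⊥)
  × (∀ i j → i ≢ j → IsArc r (T i ++ T j))
  × (∀ i → IsArc r (T i))

InI : ℕ → ℕ × ℕ → Set
InI n (x , y) = x < n × y < n

redPt : (r : ℕ) → .{{_ : NonZero r}} → ℕ × ℕ → Pt
redPt r (x , y) = aff (x % r) (y % r)

redLn : (r : ℕ) → .{{_ : NonZero r}} → ℕ × ℕ → Ln
redLn r (a , b) = par (a % r) (b % r)

IsGenericLocalArc : (k n r : ℕ) → .{{_ : NonZero r}} → {m : ℕ} →
                    (Fin m → List (ℕ × ℕ)) → (Fin m → List (ℕ × ℕ)) → Set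
IsGenericLocalArc k n r {m} S L =
    (∀ i → All (InI n) (S i) × Unique (S i) × length (S i) ≡ k)
  × (∀ i → All (InI n) (L i) × Unique (L i) × length (L i) ≡ k C 2)
  × IsLocalArc r k (λ i → map (redPt r) (S i))
  × (∀ j (ℓ : Ln) → (ℓ ∈ map (redLn r) (L j) → IsSecant r (map (redPt r) (S j)) ℓ)
                  × (IsSecant r (map (redPt r) (S j)) ℓ → ℓ ∈ map (redLn r) (L j)))
  × (∀ i j x y a b → (x , y) ∈ S i → (a , b) ∈ L j →
       Inc r (redPt r (x , y)) (redLn r (a , b)) →
       ((+ x - + a) ^ 2 ≡ + y - + b) × (+ 0 ℤ.≤ + y - + b))

IsGenericArc : ℕ → List (ℕ × ℕ) → Set
IsGenericArc k S =
  Σ ℕ λ n → Σ (List (ℕ × ℕ)) λ L →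
    ∀ (r : ℕ) → .{{_ : NonZero r}} → Prime r → n < r →
      IsGenericLocalArc k n r (λ (_ : Fin 1) → S) (λ _ → L)

D : ℕ → List (ℕ × ℕ)
D k = map (λ i → (⌈ k ℕ.* k /2⌉ ℕ.+ 2 ℕ.* i , 2 ℕ.* (⌈ k ℕ.* k /2⌉ ℕ.+ 2 ℕ.* i))) (upTo k)

{-# OPTIONS --safe #-}
-- The points of D are P_t = (x_t, 2x_t) with x_t = ⌈k²/2⌉ + 2t, t < k. For i < j the
-- parabola line through P_i and P_j is [x_i + e, 2x_i − e²] with e = j − i − 1, and its
-- defect at P_t, (y_t − b) − (x_t − a)², is exactly −4(t − i)(t − j). Reduced modulo a
-- prime r > 4 exceeding every coordinate, P_t therefore lies on the reduced chord only
-- for t ∈ {i, j}. Since two points with distinct x-coordinates lie on at most one line,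
-- every secant of the reduced set is a reduced chord containing no third point: this
-- gives (a) and (b). For (c), an incidence modulo r forces t ∈ {i, j}, so the integer
-- defect vanishes. The choice ⌈k²/2⌉ makes b = 2x_i − e² ≥ 0, since e² < k² ≤ 2⌈k²/2⌉.
module Submission where

open import Defs
open import Data.Nat using (ℕ; _<_)

open import Data.Nat using (zero; suc; z<s; z≤n; _≤_; _∸_; s≤s; NonZero; ⌈_/2⌉; ⌊_/2⌋)
import Data.Nat as ℕ
import Data.Nat.Properties as ℕₚ
open import Data.Nat.DivMod using (_%_; _/_; m%n<n; m<n⇒m%n≡m; m≡m%n+[m/n]*n)
open import Data.Nat.Divisibility using (∣⇒≤) renaming (_∣_ to _∣ℕ_)
open import Data.Nat.Primality using (Prime; euclidsLemma; prime⇒nonZero)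
open import Data.Nat.Combinatorics using (_C_; nC1≡n; nCk+nC[k+1]≡[n+1]C[k+1])
open import Data.Integer as ℤ using (ℤ; +_; -[1+_]; 0ℤ; _+_; _-_; _*_; -_; _^_; +≤+)
import Data.Integer.Properties as ℤₚ
open import Data.Integer.Divisibility.Signed
  using (_∣_; divides; ∣ᵤ⇒∣; ∣⇒∣ᵤ; ∣m∣n⇒∣m+n; ∣m∣n⇒∣m-n; ∣m+n∣n⇒∣m; ∣m⇒∣-m; ∣m⇒∣m*n)
open import Data.Integer.Solver using (module +-*-Solver)
open +-*-Solver using (Polynomial; solve; _:=_; _:+_; _:-_; :-_; _:*_; _:^_; con)
open import Data.Integer.Tactic.RingSolver using (solve-∀)
open import Data.Product using (∃-syntax; _×_; _,_; proj₁; proj₂)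
open import Data.Sum using (_⊎_; inj₁; inj₂; [_,_]′)
import Data.Sum as Sum
open import Data.Maybe using (just; nothing)
open import Data.Fin using (Fin)
open import Data.List using (List; []; _∷_; length; map; upTo; _++_)
open import Data.List.Properties using (length-++; length-map; length-upTo; map-∘)
open import Data.List.Membership.Propositional using (_∈_)
open import Data.List.Membership.Propositional.Properties
  using (∈-map⁺; ∈-map⁻; ∈-++⁺ˡ; ∈-++⁺ʳ; ∈-++⁻; ∈-upTo⁺; ∈-upTo⁻)
open import Data.List.Relation.Unary.Any using (here; there)
open import Data.List.Relation.Unary.All as All using (All)
import Data.List.Relation.Unary.All.Properties as Allₚ
open import Data.List.Relation.Unary.AllPairs using ([]; _∷_)
open import Data.List.Relation.Unary.Unique.Propositional using (Unique)
import Data.List.Relation.Unary.Unique.Propositional.Properties as Uniqueₚ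
open import Function using (_∘_; id)
open import Function.Bundles using (_⇔_; mk⇔; Equivalence)
open Equivalence using (to; from)
import Function.Properties.Equivalence as ⇔
open import Relation.Binary.PropositionalEquality
  using (_≡_; _≢_; refl; sym; trans; cong; cong₂; subst; module ≡-Reasoning)
open import Relation.Binary.Definitions using (tri<; tri≈; tri>)
open import Relation.Nullary using (¬_; contradiction)

map⁺-injectiveOn : ∀ {a b} {A : Set a} {B : Set b} {f : A → B} {xs : List A} →
                   (∀ {x y} → x ∈ xs → y ∈ xs → f x ≡ f y → x ≡ y) →
                   Unique xs → Unique (map f xs)
map⁺-injectiveOn {xs = []}     _   []               = []
map⁺-injectiveOn {xs = x ∷ xs} inj (x∉xs ∷ unique) =
  Allₚ.map⁺ (All.tabulate λ y∈xs fx≡fy → All.lookup x∉xs y∈xs (inj (here refl) (there y∈xs) fx≡fy))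
  ∷ map⁺-injectiveOn (λ x∈xs y∈xs → inj (there x∈xs) (there y∈xs)) unique

ascendingPairs : ℕ → List (ℕ × ℕ)
ascendingPairs zero    = []
ascendingPairs (suc n) = ascendingPairs n ++ map (_, n) (upTo n)

∈-ascendingPairs⁻ : ∀ n {i j} → (i , j) ∈ ascendingPairs n → i < j × j < n
∈-ascendingPairs⁻ (suc n) ij∈ with ∈-++⁻ (ascendingPairs n) ij∈
... | inj₁ ij∈old = let i<j , j<n = ∈-ascendingPairs⁻ n ij∈old in i<j , ℕₚ.m<n⇒m<1+n j<n
... | inj₂ ij∈new with ∈-map⁻ (_, n) ij∈new
...   | _ , i∈ , refl = ∈-upTo⁻ i∈ , ℕₚ.n<1+n n

∈-ascendingPairs⁺ : ∀ {n i j} → i < j → j < n → (i , j) ∈ ascendingPairs n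
∈-ascendingPairs⁺ {suc n} i<j (s≤s j≤n) with ℕₚ.m≤n⇒m<n∨m≡n j≤n
... | inj₁ j<n  = ∈-++⁺ˡ (∈-ascendingPairs⁺ i<j j<n)
... | inj₂ refl = ∈-++⁺ʳ (ascendingPairs n) (∈-map⁺ (_, n) (∈-upTo⁺ i<j))

ascendingPairs-unique : ∀ n → Unique (ascendingPairs n)
ascendingPairs-unique zero    = []
ascendingPairs-unique (suc n) =
  Uniqueₚ.++⁺ (ascendingPairs-unique n) (Uniqueₚ.map⁺ (cong proj₁) (Uniqueₚ.upTo⁺ n)) disjoint
  where
  disjoint : ∀ {p} → ¬ (p ∈ ascendingPairs n × p ∈ map (_, n) (upTo n))
  disjoint (p∈old , p∈new) with ∈-map⁻ (_, n) p∈new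
  ... | _ , _ , refl = ℕₚ.<-irrefl refl (proj₂ (∈-ascendingPairs⁻ n p∈old))

length-ascendingPairs : ∀ n → length (ascendingPairs n) ≡ n C 2
length-ascendingPairs zero    = refl
length-ascendingPairs (suc n) = begin
  length (ascendingPairs n ++ map (_, n) (upTo n))
    ≡⟨ length-++ (ascendingPairs n) ⟩
  length (ascendingPairs n) ℕ.+ length (map (_, n) (upTo n))
    ≡⟨ cong₂ ℕ._+_ (length-ascendingPairs n) (trans (length-map (_, n) (upTo n)) (length-upTo n)) ⟩
  n C 2 ℕ.+ n
    ≡⟨ ℕₚ.+-comm (n C 2) n ⟩
  n ℕ.+ n C 2
    ≡⟨ cong (ℕ._+ n C 2) (nC1≡n n) ⟨
  n C 1 ℕ.+ n C 2
    ≡⟨ nCk+nC[k+1]≡[n+1]C[k+1] n 1 ⟩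
  suc n C 2 ∎
  where open ≡-Reasoning

∣∧<⇒≡0 : ∀ {p d} → p ∣ℕ d → d < p → d ≡ 0
∣∧<⇒≡0 {d = zero}  _   _   = refl
∣∧<⇒≡0 {d = suc _} p∣d d<p = contradiction (∣⇒≤ p∣d) (ℕₚ.<⇒≱ d<p)

∣[m-n]⇒m≡n : ∀ {p m n} → m < p → n < p → + p ∣ + m - + n → m ≡ n
∣[m-n]⇒m≡n {p} {m} {n} m<p n<p p∣m-n =
  ℤₚ.+-injective (ℤₚ.i-j≡0⇒i≡j (+ m) (+ n) (ℤₚ.∣i∣≡0⇒i≡0 (∣∧<⇒≡0 (∣⇒∣ᵤ p∣m-n) ∣m-n∣<p)))
  where
  ∣m-n∣<p : ℤ.∣ + m - + n ∣ < p
  ∣m-n∣<p = subst (_< p) (cong ℤ.∣_∣ (sym (ℤₚ.m-n≡m⊖n m n)))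
                  (ℕₚ.≤-<-trans (ℤₚ.∣m⊝n∣≤m⊔n m n) (ℕₚ.⊔-lub m<p n<p))

prime∣*⇒∣⊎∣ : ∀ {p} i j → Prime p → + p ∣ i * j → + p ∣ i ⊎ + p ∣ j
prime∣*⇒∣⊎∣ i j p-prime p∣ij =
  Sum.map ∣ᵤ⇒∣ ∣ᵤ⇒∣ (euclidsLemma ℤ.∣ i ∣ ℤ.∣ j ∣ p-prime (subst (_ ∣ℕ_) (ℤₚ.abs-* i j) (∣⇒∣ᵤ p∣ij)))

prime∣m*i⇒∣i : ∀ {p m} i → Prime p → 0 < m → m < p → + p ∣ + m * i → + p ∣ i
prime∣m*i⇒∣i {m = m} i p-prime 0<m m<p p∣mi =
  [ (λ p∣m → contradiction (∣∧<⇒≡0 (∣⇒∣ᵤ p∣m) m<p) (ℕₚ.>⇒≢ 0<m)) , id ]′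
    (prime∣*⇒∣⊎∣ (+ m) i p-prime p∣mi)

defect : ℤ × ℤ → ℤ × ℤ → ℤ
defect (x , y) (a , b) = (y - b) - (x - a) ^ 2

toℤ² : ℕ × ℕ → ℤ × ℤ
toℤ² (x , y) = (+ x , + y)

-- ⟦ defectᵖ x y a b ⟧ unfolds to defect (x , y) (a , b), so the solver can prove
-- identities stated in terms of defect.
defectᵖ : ∀ {n} → Polynomial n → Polynomial n → Polynomial n → Polynomial n → Polynomial n
defectᵖ x y a b = (y :- b) :- (x :- a) :^ 2

defect-difference : ∀ x y a b x′ y′ a′ b′ →
  defect (x , y) (a , b) - defect (x′ , y′) (a′ , b′)
    ≡ ((y - y′) - (b - b′)) - ((x - x′) - (a - a′)) * ((x - a) + (x′ - a′))
defect-difference = solve 8 (λ x y a b x′ y′ a′ b′ →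
  defectᵖ x y a b :- defectᵖ x′ y′ a′ b′
    := ((y :- y′) :- (b :- b′)) :- ((x :- x′) :- (a :- a′)) :* ((x :- a) :+ (x′ :- a′))) refl

∣-resp-congruence : ∀ {r i j} → r ∣ i - j → (r ∣ i ⇔ r ∣ j)
∣-resp-congruence {r} {i} {j} r∣i-j = mk⇔
  (λ r∣i → subst (r ∣_) (i-[i-j]≡j i j) (∣m∣n⇒∣m-n r∣i r∣i-j))
  (λ r∣j → subst (r ∣_) ([i-j]+j≡i i j) (∣m∣n⇒∣m+n r∣i-j r∣j))
  where
  i-[i-j]≡j : ∀ i j → i - (i - j) ≡ j
  i-[i-j]≡j = solve-∀
  [i-j]+j≡i : ∀ i j → (i - j) + j ≡ i
  [i-j]+j≡i = solve-∀

module _ {r : ℕ} {{_ : NonZero r}} where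

  ∣[m-m%r] : ∀ m → + r ∣ + m - + (m % r)
  ∣[m-m%r] m = divides (+ (m / r)) (begin
    + m - + (m % r)
      ≡⟨ cong (λ n → + n - + (m % r)) (m≡m%n+[m/n]*n m r) ⟩
    + (m % r ℕ.+ m / r ℕ.* r) - + (m % r)
      ≡⟨ cong (_- + (m % r)) (trans (ℤₚ.pos-+ (m % r) (m / r ℕ.* r)) (cong (_+_ (+ (m % r))) (ℤₚ.pos-* (m / r) r))) ⟩
    (+ (m % r) + + (m / r) * + r) - + (m % r)
      ≡⟨ [i+j]-i≡j (+ (m % r)) (+ (m / r) * + r) ⟩
    + (m / r) * + r ∎)
    where
    open ≡-Reasoning
    [i+j]-i≡j : ∀ i j → (i + j) - i ≡ j
    [i+j]-i≡j = solve-∀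

  defect-mod : ∀ x y a b →
    + r ∣ defect (toℤ² (x , y)) (toℤ² (a , b)) - defect (toℤ² (x % r , y % r)) (toℤ² (a % r , b % r))
  defect-mod x y a b =
    subst (+ r ∣_)
      (sym (defect-difference (+ x) (+ y) (+ a) (+ b) (+ (x % r)) (+ (y % r)) (+ (a % r)) (+ (b % r))))
      (∣m∣n⇒∣m-n (∣m∣n⇒∣m-n (∣[m-m%r] y) (∣[m-m%r] b))
                 (∣m⇒∣m*n ((+ x - + a) + (+ (x % r) - + (a % r))) (∣m∣n⇒∣m-n (∣[m-m%r] x) (∣[m-m%r] a))))

  Inc-red⇔ : ∀ p ℓ → Inc r (redPt r p) (redLn r ℓ) ⇔ + r ∣ defect (toℤ² p) (toℤ² ℓ)
  Inc-red⇔ (x , y) (a , b) = ⇔.trans (mk⇔ ∣ᵤ⇒∣ ∣⇒∣ᵤ) (⇔.sym (∣-resp-congruence (defect-mod x y a b)))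

  redPt-valid : ∀ p → ValidPt r (redPt r p)
  redPt-valid (x , y) = m%n<n x r , m%n<n y r

  redLn-valid : ∀ ℓ → ValidLn r (redLn r ℓ)
  redLn-valid (a , b) = m%n<n a r , m%n<n b r

defect-two-lines : ∀ x y a b a′ b′ →
  defect (x , y) (a , b) - defect (x , y) (a′ , b′) ≡ (b′ - b) + (a - a′) * (+ 2 * x - a - a′)
defect-two-lines = solve 6 (λ x y a b a′ b′ →
  defectᵖ x y a b :- defectᵖ x y a′ b′
    := (b′ :- b) :+ (a :- a′) :* (con (+ 2) :* x :- a :- a′)) refl

defect-two-points-two-lines : ∀ x₁ y₁ x₂ y₂ a b a′ b′ →
  (defect (x₁ , y₁) (a , b) - defect (x₁ , y₁) (a′ , b′)) - (defect (x₂ , y₂) (a , b) - defect (x₂ , y₂) (a′ , b′))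
    ≡ + 2 * ((x₁ - x₂) * (a - a′))
defect-two-points-two-lines = solve 8 (λ x₁ y₁ x₂ y₂ a b a′ b′ →
  (defectᵖ x₁ y₁ a b :- defectᵖ x₁ y₁ a′ b′) :- (defectᵖ x₂ y₂ a b :- defectᵖ x₂ y₂ a′ b′)
    := con (+ 2) :* ((x₁ :- x₂) :* (a :- a′))) refl

line-unique : ∀ {r x₁ y₁ x₂ y₂} {ℓ ℓ′ : Ln} → Prime r → 2 < r → ValidLn r ℓ → ValidLn r ℓ′ →
  x₁ < r → x₂ < r → x₁ ≢ x₂ →
  Inc r (aff x₁ y₁) ℓ → Inc r (aff x₂ y₂) ℓ → Inc r (aff x₁ y₁) ℓ′ → Inc r (aff x₂ y₂) ℓ′ → ℓ ≡ ℓ′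
line-unique {r} {x₁} {y₁} {x₂} {y₂} {par a b} {par a′ b′}
            r-prime 2<r (a<r , b<r) (a′<r , b′<r) x₁<r x₂<r x₁≢x₂ on₁ on₂ on₁′ on₂′ =
  cong₂ par (∣[m-n]⇒m≡n a<r a′<r r∣a-a′) (sym (∣[m-n]⇒m≡n b′<r b<r r∣b′-b))
  where
  r∣Δ : ∀ x y → Inc r (aff x y) (par a b) → Inc r (aff x y) (par a′ b′) →
        + r ∣ defect (+ x , + y) (+ a , + b) - defect (+ x , + y) (+ a′ , + b′)
  r∣Δ x y on on′ =
    ∣m∣n⇒∣m-n (∣ᵤ⇒∣ {i = defect (+ x , + y) (+ a , + b)} on) (∣ᵤ⇒∣ {i = defect (+ x , + y) (+ a′ , + b′)} on′)
  r∣2[x₁-x₂][a-a′] : + r ∣ + 2 * ((+ x₁ - + x₂) * (+ a - + a′))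
  r∣2[x₁-x₂][a-a′] =
    subst (+ r ∣_) (defect-two-points-two-lines (+ x₁) (+ y₁) (+ x₂) (+ y₂) (+ a) (+ b) (+ a′) (+ b′))
      (∣m∣n⇒∣m-n (r∣Δ x₁ y₁ on₁ on₁′) (r∣Δ x₂ y₂ on₂ on₂′))
  r∣a-a′ : + r ∣ + a - + a′
  r∣a-a′ = [ (λ r∣x₁-x₂ → contradiction (∣[m-n]⇒m≡n x₁<r x₂<r r∣x₁-x₂) x₁≢x₂) , id ]′
    (prime∣*⇒∣⊎∣ (+ x₁ - + x₂) (+ a - + a′) r-prime (prime∣m*i⇒∣i _ r-prime z<s 2<r r∣2[x₁-x₂][a-a′]))
  r∣b′-b : + r ∣ + b′ - + b
  r∣b′-b = ∣m+n∣n⇒∣m (subst (+ r ∣_) (defect-two-lines (+ x₁) (+ y₁) (+ a) (+ b) (+ a′) (+ b′)) (r∣Δ x₁ y₁ on₁ on₁′))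
                     (∣m⇒∣m*n _ r∣a-a′)
line-unique {ℓ = par _ _} {vert (just _)} _ _ _ _ _ _ x₁≢x₂ _ _ on₁′ on₂′ =
  contradiction (trans on₁′ (sym on₂′)) x₁≢x₂
line-unique {ℓ = par _ _} {vert nothing} _ _ _ _ _ _ _ _ _ () _
line-unique {ℓ = vert (just _)} _ _ _ _ _ _ x₁≢x₂ on₁ on₂ _ _ =
  contradiction (trans on₁ (sym on₂)) x₁≢x₂
line-unique {ℓ = vert nothing} _ _ _ _ _ _ _ () _ _ _

0≤i^2 : ∀ i → 0ℤ ℤ.≤ i ^ 2
0≤i^2 i = subst (0ℤ ℤ.≤_) (cong (i *_) (sym (ℤₚ.*-identityʳ i))) (0≤i*i i)
  where
  0≤i*i : ∀ i → 0ℤ ℤ.≤ i * i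
  0≤i*i (+ n)    = subst (0ℤ ℤ.≤_) (ℤₚ.pos-* n n) (+≤+ z≤n)
  0≤i*i -[1+ n ] = +≤+ z≤n

defect≡0⇒on-parabola : ∀ {x y a b} → defect (x , y) (a , b) ≡ 0ℤ → (x - a) ^ 2 ≡ y - b × 0ℤ ℤ.≤ y - b
defect≡0⇒on-parabola {x} {y} {a} {b} defect≡0 =
  sym y-b≡[x-a]² , subst (0ℤ ℤ.≤_) (sym y-b≡[x-a]²) (0≤i^2 (x - a))
  where
  y-b≡[x-a]² : y - b ≡ (x - a) ^ 2
  y-b≡[x-a]² = ℤₚ.i-j≡0⇒i≡j (y - b) ((x - a) ^ 2) defect≡0

pos-∸ : ∀ {m n} → n ≤ m → + (m ∸ n) ≡ + m - + n
pos-∸ {m} {n} n≤m = trans (sym (ℤₚ.⊖-≥ n≤m)) (sym (ℤₚ.m-n≡m⊖n m n))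

n≤2*⌈n/2⌉ : ∀ n → n ≤ 2 ℕ.* ⌈ n /2⌉
n≤2*⌈n/2⌉ n = begin
  n                   ≡⟨ ℕₚ.⌊n/2⌋+⌈n/2⌉≡n n ⟨
  ⌊ n /2⌋ ℕ.+ ⌈ n /2⌉ ≤⟨ ℕₚ.+-monoˡ-≤ ⌈ n /2⌉ (ℕₚ.⌊n/2⌋≤⌈n/2⌉ n) ⟩
  ⌈ n /2⌉ ℕ.+ ⌈ n /2⌉ ≡⟨ cong (ℕ._+_ ⌈ n /2⌉) (ℕₚ.+-identityʳ ⌈ n /2⌉) ⟨
  2 ℕ.* ⌈ n /2⌉       ∎
  where open ℕₚ.≤-Reasoning

xcoord : ℕ → ℕ → ℕ
xcoord k t = ⌈ k ℕ.* k /2⌉ ℕ.+ 2 ℕ.* t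

point : ℕ → ℕ → ℕ × ℕ
point k t = (xcoord k t , 2 ℕ.* xcoord k t)

-- The parabola line through point k i and point k j (i < j): its vertex lies
-- gap = j − i − 1 to the right of point k i and gap² below it.
secant : ℕ → ℕ × ℕ → ℕ × ℕ
secant k (i , j) = (xcoord k i ℕ.+ (j ∸ suc i) , 2 ℕ.* xcoord k i ∸ (j ∸ suc i) ℕ.* (j ∸ suc i))

secants : ℕ → List (ℕ × ℕ)
secants k = map (secant k) (ascendingPairs k)

bound : ℕ → ℕ
bound k = 2 ℕ.* xcoord k k

xcoord-injective : ∀ k {t t′} → xcoord k t ≡ xcoord k t′ → t ≡ t′
xcoord-injective k {t} {t′} =
  ℕₚ.*-cancelˡ-≡ t t′ 2 ∘ ℕₚ.+-cancelˡ-≡ ⌈ k ℕ.* k /2⌉ (2 ℕ.* t) (2 ℕ.* t′)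

t≤xcoord : ∀ k t → t ≤ xcoord k t
t≤xcoord k t = ℕₚ.≤-trans (ℕₚ.m≤n*m t 2) (ℕₚ.m≤n+m (2 ℕ.* t) ⌈ k ℕ.* k /2⌉)

xcoord-< : ∀ {k t} → t < k → xcoord k t < xcoord k k
xcoord-< {k} t<k = ℕₚ.+-monoʳ-< ⌈ k ℕ.* k /2⌉ (ℕₚ.*-monoʳ-< 2 t<k)

gap²≤2*xcoord : ∀ {k i j} → j ≤ k → (j ∸ suc i) ℕ.* (j ∸ suc i) ≤ 2 ℕ.* xcoord k i
gap²≤2*xcoord {k} {i} {j} j≤k = begin
  (j ∸ suc i) ℕ.* (j ∸ suc i) ≤⟨ ℕₚ.*-mono-≤ gap≤k gap≤k ⟩
  k ℕ.* k                     ≤⟨ n≤2*⌈n/2⌉ (k ℕ.* k) ⟩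
  2 ℕ.* ⌈ k ℕ.* k /2⌉         ≤⟨ ℕₚ.*-monoʳ-≤ 2 (ℕₚ.m≤m+n ⌈ k ℕ.* k /2⌉ (2 ℕ.* i)) ⟩
  2 ℕ.* xcoord k i            ∎
  where
  open ℕₚ.≤-Reasoning
  gap≤k : j ∸ suc i ≤ k
  gap≤k = ℕₚ.≤-trans (ℕₚ.m∸n≤m j (suc i)) j≤k

point-bounded : ∀ {k t} → t < k → InI (bound k) (point k t)
point-bounded {k} {t} t<k = ℕₚ.≤-<-trans (ℕₚ.m≤n*m (xcoord k t) 2) y<bound , y<bound
  where
  y<bound : 2 ℕ.* xcoord k t < bound k
  y<bound = ℕₚ.*-monoʳ-< 2 (xcoord-< t<k)

secant-bounded : ∀ {k i j} → i < j → j < k → InI (bound k) (secant k (i , j))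
secant-bounded {k} {i} {j} i<j j<k =
  a<bound , ℕₚ.≤-<-trans (ℕₚ.m∸n≤m (2 ℕ.* xcoord k i) ((j ∸ suc i) ℕ.* (j ∸ suc i))) (ℕₚ.*-monoʳ-< 2 (xcoord-< i<k))
  where
  open ℕₚ.≤-Reasoning
  i<k : i < k
  i<k = ℕₚ.<-trans i<j j<k
  a<bound : xcoord k i ℕ.+ (j ∸ suc i) < bound k
  a<bound = begin-strict
    xcoord k i ℕ.+ (j ∸ suc i) <⟨ ℕₚ.+-mono-< (xcoord-< i<k) (ℕₚ.≤-<-trans (ℕₚ.m∸n≤m j (suc i)) j<k) ⟩
    xcoord k k ℕ.+ k           ≤⟨ ℕₚ.+-monoʳ-≤ (xcoord k k) (t≤xcoord k k) ⟩
    xcoord k k ℕ.+ xcoord k k  ≡⟨ cong (ℕ._+_ (xcoord k k)) (ℕₚ.+-identityʳ (xcoord k k)) ⟨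
    bound k                    ∎

chord-defect : ∀ c t i e →
  defect (c + + 2 * t , + 2 * (c + + 2 * t)) (c + + 2 * i + e , + 2 * (c + + 2 * i) - e * e)
    ≡ - (+ 4 * ((t - i) * (t - (+ 1 + i + e))))
chord-defect = solve 4 (λ c t i e →
  defectᵖ (c :+ con (+ 2) :* t) (con (+ 2) :* (c :+ con (+ 2) :* t))
          (c :+ con (+ 2) :* i :+ e) (con (+ 2) :* (c :+ con (+ 2) :* i) :- e :* e)
    := :- (con (+ 4) :* ((t :- i) :* (t :- (con (+ 1) :+ i :+ e))))) refl

defect-point-secant : ∀ {k i j} t → i < j → j ≤ k →
  defect (toℤ² (point k t)) (toℤ² (secant k (i , j))) ≡ - (+ 4 * ((+ t - + i) * (+ t - + j)))
defect-point-secant {k} {i} {j} t i<j j≤k = begin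
  defect (toℤ² (point k t)) (toℤ² (secant k (i , j)))
    ≡⟨ cong₂ defect (cong₂ _,_ (x≡ t) (y≡ t)) (cong₂ _,_ a≡ b≡) ⟩
  defect (c + + 2 * + t , + 2 * (c + + 2 * + t)) (c + + 2 * + i + e , + 2 * (c + + 2 * + i) - e * e)
    ≡⟨ chord-defect c (+ t) (+ i) e ⟩
  - (+ 4 * ((+ t - + i) * (+ t - (+ 1 + + i + e))))
    ≡⟨ cong (λ j′ → - (+ 4 * ((+ t - + i) * (+ t - j′)))) j≡ ⟨
  - (+ 4 * ((+ t - + i) * (+ t - + j))) ∎
  where
  open ≡-Reasoning
  gap : ℕ
  gap = j ∸ suc i
  c e : ℤ
  c = + ⌈ k ℕ.* k /2⌉
  e = + gap
  x≡ : ∀ s → + xcoord k s ≡ c + + 2 * + s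
  x≡ s = trans (ℤₚ.pos-+ ⌈ k ℕ.* k /2⌉ (2 ℕ.* s)) (cong (_+_ c) (ℤₚ.pos-* 2 s))
  y≡ : ∀ s → + (2 ℕ.* xcoord k s) ≡ + 2 * (c + + 2 * + s)
  y≡ s = trans (ℤₚ.pos-* 2 (xcoord k s)) (cong (_*_ (+ 2)) (x≡ s))
  a≡ : + (xcoord k i ℕ.+ gap) ≡ c + + 2 * + i + e
  a≡ = trans (ℤₚ.pos-+ (xcoord k i) gap) (cong (_+ e) (x≡ i))
  b≡ : + (2 ℕ.* xcoord k i ∸ gap ℕ.* gap) ≡ + 2 * (c + + 2 * + i) - e * e
  b≡ = trans (pos-∸ (gap²≤2*xcoord j≤k)) (cong₂ _-_ (y≡ i) (ℤₚ.pos-* gap gap))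
  j≡ : + j ≡ + 1 + + i + e
  j≡ = trans (cong +_ (sym (ℕₚ.m+[n∸m]≡n i<j))) (trans (ℤₚ.pos-+ (suc i) gap) (cong (_+ e) (ℤₚ.pos-+ 1 i)))

defect-point-secant≡0 : ∀ {k i j t} → i < j → j ≤ k → t ≡ i ⊎ t ≡ j →
  defect (toℤ² (point k t)) (toℤ² (secant k (i , j))) ≡ 0ℤ
defect-point-secant≡0 {t = t} i<j j≤k t∈ij =
  trans (defect-point-secant t i<j j≤k) (cong (λ z → - (+ 4 * z)) (product≡0 t∈ij))
  where
  product≡0 : ∀ {t i j} → t ≡ i ⊎ t ≡ j → (+ t - + i) * (+ t - + j) ≡ 0ℤ
  product≡0 {t} {j = j} (inj₁ refl) =
    trans (cong (_* (+ t - + j)) (ℤₚ.+-inverseʳ (+ t))) (ℤₚ.*-zeroˡ (+ t - + j))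
  product≡0 {t} {i}     (inj₂ refl) =
    trans (cong (_*_ (+ t - + i)) (ℤₚ.+-inverseʳ (+ t))) (ℤₚ.*-zeroʳ (+ t - + i))

point-injective : ∀ k {t t′} → point k t ≡ point k t′ → t ≡ t′
point-injective k = xcoord-injective k ∘ cong proj₁

∈-D⁻ : ∀ k {p} → p ∈ D k → ∃[ t ] t < k × p ≡ point k t
∈-D⁻ k p∈ = let t , t∈ , p≡ = ∈-map⁻ (point k) p∈ in t , ∈-upTo⁻ t∈ , p≡

∈-secants⁻ : ∀ k {ℓ} → ℓ ∈ secants k → ∃[ i ] ∃[ j ] i < j × j < k × ℓ ≡ secant k (i , j)
∈-secants⁻ k ℓ∈ =
  let (i , j) , ij∈ , ℓ≡ = ∈-map⁻ (secant k) ℓ∈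
      i<j , j<k = ∈-ascendingPairs⁻ k ij∈
  in  i , j , i<j , j<k , ℓ≡

D-bounded : ∀ k → All (InI (bound k)) (D k)
D-bounded k = Allₚ.map⁺ (All.tabulate λ t∈ → point-bounded (∈-upTo⁻ t∈))

D-unique : ∀ k → Unique (D k)
D-unique k = Uniqueₚ.map⁺ (point-injective k) (Uniqueₚ.upTo⁺ k)

length-D : ∀ k → length (D k) ≡ k
length-D k = trans (length-map (point k) (upTo k)) (length-upTo k)

secants-bounded : ∀ k → All (InI (bound k)) (secants k)
secants-bounded k = Allₚ.map⁺ (All.tabulate λ ij∈ →
  let i<j , j<k = ∈-ascendingPairs⁻ k ij∈ in secant-bounded i<j j<k)

length-secants : ∀ k → length (secants k) ≡ k C 2
length-secants k = trans (length-map (secant k) (ascendingPairs k)) (length-ascendingPairs k)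

aff-injectiveˡ : ∀ {x y x′ y′} → aff x y ≡ aff x′ y′ → x ≡ x′
aff-injectiveˡ refl = refl

ascending-pair-≡ : ∀ {i j i′ j′} → i < j → i′ < j′ → i ≡ i′ ⊎ i ≡ j′ → j ≡ i′ ⊎ j ≡ j′ → (i , j) ≡ (i′ , j′)
ascending-pair-≡ i<j _     (inj₁ refl) (inj₁ refl) = contradiction refl (ℕₚ.<⇒≢ i<j)
ascending-pair-≡ _   _     (inj₁ refl) (inj₂ refl) = refl
ascending-pair-≡ i<j i′<j′ (inj₂ refl) (inj₁ refl) = contradiction (ℕₚ.<-trans i<j i′<j′) (ℕₚ.<-irrefl refl)
ascending-pair-≡ i<j _     (inj₂ refl) (inj₂ refl) = contradiction refl (ℕₚ.<⇒≢ i<j)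

singleton-isLocalArc : ∀ {r k} {T : List Pt} →
  All (ValidPt r) T → Unique T → length T ≡ k → IsArc r T → IsLocalArc r k (λ (_ : Fin 1) → T)
singleton-isLocalArc valid unique length≡k arc =
  (λ _ → valid , unique , length≡k) , (λ i j i≢j → contradiction (Fin1-≡ i j) i≢j) ,
  (λ i j i≢j → contradiction (Fin1-≡ i j) i≢j) , (λ _ → arc)
  where
  Fin1-≡ : (i j : Fin 1) → i ≡ j
  Fin1-≡ Fin.zero Fin.zero = refl

module _ {k : ℕ} (0<k : 0 < k) {r : ℕ} (r-prime : Prime r) (bound<r : bound k < r) where

  private
    instance
      r≢0 : NonZero r
      r≢0 = prime⇒nonZero r-prime

  xcoord<r : ∀ {t} → t < k → xcoord k t < r
  xcoord<r t<k = ℕₚ.<-trans (proj₁ (point-bounded t<k)) bound<r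

  <k⇒<r : ∀ {t} → t < k → t < r
  <k⇒<r {t} t<k = ℕₚ.≤-<-trans (t≤xcoord k t) (xcoord<r t<k)

  4<r : 4 < r
  4<r = ℕₚ.≤-<-trans (ℕₚ.*-monoʳ-≤ 2 2≤xcoord) bound<r
    where
    2≤xcoord : 2 ≤ xcoord k k
    2≤xcoord = ℕₚ.≤-trans (ℕₚ.*-monoʳ-≤ 2 0<k) (ℕₚ.m≤n+m (2 ℕ.* k) ⌈ k ℕ.* k /2⌉)

  2<r : 2 < r
  2<r = ℕₚ.≤-<-trans (ℕₚ.m≤n+m 2 2) 4<r

  pointᵣ : ℕ → Pt
  pointᵣ t = redPt r (point k t)

  secantᵣ : ℕ × ℕ → Ln
  secantᵣ ij = redLn r (secant k ij)

  Dᵣ : List Pt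
  Dᵣ = map (redPt r) (D k)

  secantsᵣ : List Ln
  secantsᵣ = map (redLn r) (secants k)

  xcoordᵣ-injective : ∀ {t t′} → t < k → t′ < k → xcoord k t % r ≡ xcoord k t′ % r → t ≡ t′
  xcoordᵣ-injective t<k t′<k eq =
    xcoord-injective k (trans (sym (m<n⇒m%n≡m (xcoord<r t<k))) (trans eq (m<n⇒m%n≡m (xcoord<r t′<k))))

  pointᵣ-injective : ∀ {t t′} → t < k → t′ < k → pointᵣ t ≡ pointᵣ t′ → t ≡ t′
  pointᵣ-injective t<k t′<k = xcoordᵣ-injective t<k t′<k ∘ aff-injectiveˡ

  on-secantᵣ⇔ : ∀ {t i j} → t < k → i < j → j < k → Inc r (pointᵣ t) (secantᵣ (i , j)) ⇔ (t ≡ i ⊎ t ≡ j)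
  on-secantᵣ⇔ {t} {i} {j} t<k i<j j<k = mk⇔ endpoint on-if-endpoint
    where
    lifted : Inc r (pointᵣ t) (secantᵣ (i , j)) ⇔ + r ∣ defect (toℤ² (point k t)) (toℤ² (secant k (i , j)))
    lifted = Inc-red⇔ (point k t) (secant k (i , j))
    r∣4[t-i][t-j] : Inc r (pointᵣ t) (secantᵣ (i , j)) → + r ∣ + 4 * ((+ t - + i) * (+ t - + j))
    r∣4[t-i][t-j] on = subst (+ r ∣_) (ℤₚ.neg-involutive _)
      (∣m⇒∣-m (subst (+ r ∣_) (defect-point-secant t i<j (ℕₚ.<⇒≤ j<k)) (to lifted on)))
    endpoint : Inc r (pointᵣ t) (secantᵣ (i , j)) → t ≡ i ⊎ t ≡ j
    endpoint on =
      Sum.map (∣[m-n]⇒m≡n (<k⇒<r t<k) (<k⇒<r (ℕₚ.<-trans i<j j<k))) (∣[m-n]⇒m≡n (<k⇒<r t<k) (<k⇒<r j<k))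
        (prime∣*⇒∣⊎∣ (+ t - + i) (+ t - + j) r-prime (prime∣m*i⇒∣i _ r-prime z<s 4<r (r∣4[t-i][t-j] on)))
    on-if-endpoint : t ≡ i ⊎ t ≡ j → Inc r (pointᵣ t) (secantᵣ (i , j))
    on-if-endpoint t∈ij =
      from lifted (subst (+ r ∣_) (sym (defect-point-secant≡0 i<j (ℕₚ.<⇒≤ j<k) t∈ij)) (divides 0ℤ refl))

  secantᵣ-unique : ∀ {ℓ i j} → ValidLn r ℓ → i < j → j < k →
    Inc r (pointᵣ i) ℓ → Inc r (pointᵣ j) ℓ → ℓ ≡ secantᵣ (i , j)
  secantᵣ-unique {i = i} {j} valid i<j j<k on-i on-j =
    line-unique r-prime 2<r valid (redLn-valid (secant k (i , j)))
      (m%n<n (xcoord k i) r) (m%n<n (xcoord k j) r) (ℕₚ.<⇒≢ i<j ∘ xcoordᵣ-injective i<k j<k)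
      on-i on-j (from (on-secantᵣ⇔ i<k i<j j<k) (inj₁ refl)) (from (on-secantᵣ⇔ j<k i<j j<k) (inj₂ refl))
    where
    i<k : i < k
    i<k = ℕₚ.<-trans i<j j<k

  third-point-on-secantᵣ : ∀ {ℓ i j t} → ValidLn r ℓ → i < j → j < k → t < k →
    Inc r (pointᵣ i) ℓ → Inc r (pointᵣ j) ℓ → Inc r (pointᵣ t) ℓ → t ≡ i ⊎ t ≡ j
  third-point-on-secantᵣ {t = t} valid i<j j<k t<k on-i on-j on-t =
    to (on-secantᵣ⇔ t<k i<j j<k) (subst (Inc r (pointᵣ t)) (secantᵣ-unique valid i<j j<k on-i on-j) on-t)

  collinear⇒endpoint : ∀ {ℓ t₁ t₂ t₃} → ValidLn r ℓ → t₁ < k → t₂ < k → t₃ < k → t₁ ≢ t₂ →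
    Inc r (pointᵣ t₁) ℓ → Inc r (pointᵣ t₂) ℓ → Inc r (pointᵣ t₃) ℓ → t₃ ≡ t₁ ⊎ t₃ ≡ t₂
  collinear⇒endpoint {t₁ = t₁} {t₂} valid t₁<k t₂<k t₃<k t₁≢t₂ on₁ on₂ on₃ with ℕₚ.<-cmp t₁ t₂
  ... | tri< t₁<t₂ _ _ = third-point-on-secantᵣ valid t₁<t₂ t₂<k t₃<k on₁ on₂ on₃
  ... | tri≈ _ t₁≡t₂ _ = contradiction t₁≡t₂ t₁≢t₂
  ... | tri> _ _ t₂<t₁ = Sum.swap (third-point-on-secantᵣ valid t₂<t₁ t₁<k t₃<k on₂ on₁ on₃)

  ∈-Dᵣ⁻ : ∀ {p} → p ∈ Dᵣ → ∃[ t ] t < k × p ≡ pointᵣ t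
  ∈-Dᵣ⁻ p∈ =
    let q , q∈ , p≡ = ∈-map⁻ (redPt r) p∈
        t , t<k , q≡ = ∈-D⁻ k q∈
    in  t , t<k , trans p≡ (cong (redPt r) q≡)

  ∈-Dᵣ⁺ : ∀ {t} → t < k → pointᵣ t ∈ Dᵣ
  ∈-Dᵣ⁺ t<k = ∈-map⁺ (redPt r) (∈-map⁺ (point k) (∈-upTo⁺ t<k))

  ∈-secantsᵣ⁺ : ∀ {i j} → i < j → j < k → secantᵣ (i , j) ∈ secantsᵣ
  ∈-secantsᵣ⁺ i<j j<k = ∈-map⁺ (redLn r) (∈-map⁺ (secant k) (∈-ascendingPairs⁺ i<j j<k))

  Dᵣ-valid : All (ValidPt r) Dᵣ
  Dᵣ-valid = Allₚ.map⁺ (All.universal redPt-valid (D k))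

  Dᵣ-unique : Unique Dᵣ
  Dᵣ-unique = subst Unique (map-∘ (upTo k))
    (map⁺-injectiveOn (λ t∈ t′∈ → pointᵣ-injective (∈-upTo⁻ t∈) (∈-upTo⁻ t′∈)) (Uniqueₚ.upTo⁺ k))

  length-Dᵣ : length Dᵣ ≡ k
  length-Dᵣ = trans (length-map (redPt r) (D k)) (length-D k)

  Dᵣ-isArc : IsArc r Dᵣ
  Dᵣ-isArc ℓ valid p q s p∈ q∈ s∈ p≢q q≢s p≢s on-p on-q on-s
    with ∈-Dᵣ⁻ p∈ | ∈-Dᵣ⁻ q∈ | ∈-Dᵣ⁻ s∈
  ... | t₁ , t₁<k , refl | t₂ , t₂<k , refl | t₃ , t₃<k , refl =
    [ p≢s ∘ cong pointᵣ ∘ sym , q≢s ∘ cong pointᵣ ∘ sym ]′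
      (collinear⇒endpoint valid t₁<k t₂<k t₃<k (p≢q ∘ cong pointᵣ) on-p on-q on-s)

  secantᵣ-isSecant : ∀ {i j} → i < j → j < k → IsSecant r Dᵣ (secantᵣ (i , j))
  secantᵣ-isSecant {i} {j} i<j j<k =
    redLn-valid (secant k (i , j)) , pointᵣ i , pointᵣ j , ∈-Dᵣ⁺ i<k , ∈-Dᵣ⁺ j<k ,
    ℕₚ.<⇒≢ i<j ∘ pointᵣ-injective i<k j<k ,
    from (on-secantᵣ⇔ i<k i<j j<k) (inj₁ refl) , from (on-secantᵣ⇔ j<k i<j j<k) (inj₂ refl)
    where
    i<k : i < k
    i<k = ℕₚ.<-trans i<j j<k

  ∈secantsᵣ⇒isSecant : ∀ {ℓ} → ℓ ∈ secantsᵣ → IsSecant r Dᵣ ℓ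
  ∈secantsᵣ⇒isSecant ℓ∈ with ∈-map⁻ (redLn r) ℓ∈
  ... | _ , ℓ′∈ , refl with ∈-secants⁻ k ℓ′∈
  ...   | _ , _ , i<j , j<k , refl = secantᵣ-isSecant i<j j<k

  isSecant⇒∈secantsᵣ : ∀ {ℓ} → IsSecant r Dᵣ ℓ → ℓ ∈ secantsᵣ
  isSecant⇒∈secantsᵣ (valid , p , q , p∈ , q∈ , p≢q , on-p , on-q) with ∈-Dᵣ⁻ p∈ | ∈-Dᵣ⁻ q∈
  ... | t₁ , t₁<k , refl | t₂ , t₂<k , refl with ℕₚ.<-cmp t₁ t₂
  ...   | tri< t₁<t₂ _ _ =
    subst (_∈ secantsᵣ) (sym (secantᵣ-unique valid t₁<t₂ t₂<k on-p on-q)) (∈-secantsᵣ⁺ t₁<t₂ t₂<k)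
  ...   | tri≈ _ t₁≡t₂ _ = contradiction (cong pointᵣ t₁≡t₂) p≢q
  ...   | tri> _ _ t₂<t₁ =
    subst (_∈ secantsᵣ) (sym (secantᵣ-unique valid t₂<t₁ t₁<k on-q on-p)) (∈-secantsᵣ⁺ t₂<t₁ t₁<k)

  secantᵣ-injective : ∀ {i j i′ j′} → i < j → j < k → i′ < j′ → j′ < k →
    secantᵣ (i , j) ≡ secantᵣ (i′ , j′) → (i , j) ≡ (i′ , j′)
  secantᵣ-injective {i} {j} {i′} {j′} i<j j<k i′<j′ j′<k eq =
    ascending-pair-≡ i<j i′<j′ (endpoint (inj₁ refl) (ℕₚ.<-trans i<j j<k)) (endpoint (inj₂ refl) j<k)
    where
    endpoint : ∀ {t} → t ≡ i ⊎ t ≡ j → t < k → t ≡ i′ ⊎ t ≡ j′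
    endpoint {t} t∈ij t<k = to (on-secantᵣ⇔ t<k i′<j′ j′<k)
      (subst (Inc r (pointᵣ t)) eq (from (on-secantᵣ⇔ t<k i<j j<k) t∈ij))

  secants-unique : Unique (secants k)
  secants-unique = map⁺-injectiveOn injective (ascendingPairs-unique k)
    where
    injective : ∀ {p q} → p ∈ ascendingPairs k → q ∈ ascendingPairs k → secant k p ≡ secant k q → p ≡ q
    injective p∈ q∈ eq =
      let i<j , j<k = ∈-ascendingPairs⁻ k p∈
          i′<j′ , j′<k = ∈-ascendingPairs⁻ k q∈
      in  secantᵣ-injective i<j j<k i′<j′ j′<k (cong (redLn r) eq)

  incidence-is-exact : ∀ {x y a b} → (x , y) ∈ D k → (a , b) ∈ secants k →
    Inc r (redPt r (x , y)) (redLn r (a , b)) → (+ x - + a) ^ 2 ≡ + y - + b × 0ℤ ℤ.≤ + y - + b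
  incidence-is-exact {x} {y} {a} {b} p∈ ℓ∈ on with ∈-D⁻ k p∈ | ∈-secants⁻ k ℓ∈
  ... | _ , t<k , refl | _ , _ , i<j , j<k , refl =
    defect≡0⇒on-parabola {+ x} {+ y} {+ a} {+ b}
      (defect-point-secant≡0 i<j (ℕₚ.<⇒≤ j<k) (to (on-secantᵣ⇔ t<k i<j j<k) on))

  D-isGenericLocalArc : IsGenericLocalArc k (bound k) r (λ _ → D k) (λ _ → secants k)
  D-isGenericLocalArc =
      (λ _ → D-bounded k , D-unique k , length-D k)
    , (λ _ → secants-bounded k , secants-unique , length-secants k)
    , singleton-isLocalArc Dᵣ-valid Dᵣ-unique length-Dᵣ Dᵣ-isArc
    , (λ _ _ → ∈secantsᵣ⇒isSecant , isSecant⇒∈secantsᵣ)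
    , (λ _ _ _ _ _ _ → incidence-is-exact)

lemma3p2 : ∀ (k : ℕ) → 0 < k → IsGenericArc k (D k)
lemma3p2 k 0<k = bound k , secants k , λ r r-prime bound<r → D-isGenericLocalArc 0<k r-prime bound<r
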